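{- Let $S$ be a complete extended system that has neither contraction $(\mathsf C)$ nor weakening $(\mathsf W)$ among its rules. Then $S$ is equivalent to $\mathbf{Mp}$.
   Context: Formulas are built from literals (propositional variables $P$ and their complements $\bar P$) using $\wedge$ and $\vee$. Negation satisfies $\neg P=\bar P$ and is extended by De Morgan's laws. A sequent is a nonempty finite multiset of formulas. A comma denotes multiset union, and $\Gamma,\Delta,\Sigma$ denote possibly empty multisets. A formula is valid if it evaluates to $1$ under every $0/1$-assignment. Rules: - Axiom: infer $P,\neg P$ from no premises. - $(\&)$: from $\Gamma,A$ and $\Gamma,B$ infer $\Gamma,A\wedge B$. - $(\otimes)$: from $\Delta,A$ and $\Sigma,B$ infer $\Delta,\Sigma,A\wedge B$. - $(\wedge)$: from $\Gamma,\Delta,A$ and $\Gamma,\Sigma,B$ infer $\Gamma,\Delta,\Sigma,A\wedge B$. - $(\oplus)$: consists of both $(\oplus_1)$ and $(\oplus_2)$, where $(\oplus_i)$ infers $\Gamma,A_1\vee A_2$ from $\Gamma,A_i$. - $(\mathrm{par})$: from $\Gamma,A,B$ infer $\Gamma,A\vee B$. - $(\mathsf W)$: from $\Gamma$ infer $\Gamma,A$. - $(\mathsf C)$: from $\Gamma,A,A$ infer $\Gamma,A$. An extended system is the axiom together with any subset of $\{(\otimes),(\wedge),(\&),(\oplus),(\mathrm{par}),(\mathsf C),(\mathsf W)\}$. $\mathbf{Mp}$ is the axiom together with $(\wedge),(\oplus),(\mathrm{par})$. A rule is derivable in $S$ if, for every instance of it, the conclusion is derivable in $S$ from its premises used as extra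 leaves. $S$ contains $T$ if every rule of $T$ is derivable in $S$. Two systems are equivalent if each contains the other. A system is complete if every valid formula is derivable in it. -}

module Defs where

open import Data.Nat using (ℕ)
open import Data.Bool using (Bool; true; false)
open import Data.List using (List; []; _∷_; _++_)
open import Data.List.Membership.Propositional using (_∈_)
open import Data.List.Relation.Binary.Permutation.Propositional using (_↭_)
open import Data.Product using (_×_)
open import Relation.Binary.PropositionalEquality using (_≡_; _≢_)

data Literal : Set where
  pos : ℕ → Literal
  neg : ℕ → Literal

data Formula : Set where
  lit  : Literal → Formula
  _∧ᶠ_ : Formula → Formula → Formula
  _∨ᶠ_ : Formula → Formula → Formula

infixr 7 _∧ᶠ_
infixr 6 _∨ᶠ_

¬ᶠ_ : Formula → Formula
¬ᶠ lit (pos p) = lit (neg p)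
¬ᶠ lit (neg p) = lit (pos p)
¬ᶠ (A ∧ᶠ B) = (¬ᶠ A) ∨ᶠ (¬ᶠ B)
¬ᶠ (A ∨ᶠ B) = (¬ᶠ A) ∧ᶠ (¬ᶠ B)

not : Bool → Bool
not true = false
not false = true

and : Bool → Bool → Bool
and true b = b
and false _ = false

or : Bool → Bool → Bool
or true _ = true
or false b = b

eval : (ℕ → Bool) → Formula → Bool
eval ρ (lit (pos p)) = ρ p
eval ρ (lit (neg p)) = not (ρ p)
eval ρ (A ∧ᶠ B) = and (eval ρ A) (eval ρ B)
eval ρ (A ∨ᶠ B) = or (eval ρ A) (eval ρ B)

Valid : Formula → Set
Valid A = ∀ (ρ : ℕ → Bool) → eval ρ A ≡ true

-- Sequents: finite multisets of formulas, represented by lists taken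
-- up to permutation (derivability below is closed under _↭_).
Sequent : Set
Sequent = List Formula

data Rule : Set where
  tensorR wedgeR withR oplusR parR contrR weakR : Rule

-- An extended system: the axiom together with a subset of the rules.
System : Set
System = Rule → Bool

Mp : System
Mp wedgeR = true
Mp oplusR = true
Mp parR   = true
Mp _      = false

data Inst1 : Rule → Sequent → Sequent → Set where
  oplus₁ : ∀ Γ A₁ A₂ → Inst1 oplusR (A₁ ∷ Γ) ((A₁ ∨ᶠ A₂) ∷ Γ)
  oplus₂ : ∀ Γ A₁ A₂ → Inst1 oplusR (A₂ ∷ Γ) ((A₁ ∨ᶠ A₂) ∷ Γ)
  par    : ∀ Γ A B → Inst1 parR (A ∷ B ∷ Γ) ((A ∨ᶠ B) ∷ Γ)
  weak   : ∀ Γ A → Γ ≢ [] → Inst1 weakR Γ (A ∷ Γ)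
  contr  : ∀ Γ A → Inst1 contrR (A ∷ A ∷ Γ) (A ∷ Γ)

data Inst2 : Rule → Sequent → Sequent → Sequent → Set where
  with&  : ∀ Γ A B → Inst2 withR (A ∷ Γ) (B ∷ Γ) ((A ∧ᶠ B) ∷ Γ)
  tensor : ∀ Δ Σ A B → Inst2 tensorR (A ∷ Δ) (B ∷ Σ) ((A ∧ᶠ B) ∷ (Δ ++ Σ))
  wedge  : ∀ Γ Δ Σ A B →
           Inst2 wedgeR (A ∷ (Γ ++ Δ)) (B ∷ (Γ ++ Σ)) ((A ∧ᶠ B) ∷ (Γ ++ Δ ++ Σ))

data Deriv (S : System) (H : List Sequent) : Sequent → Set where
  ax    : ∀ p → Deriv S H (lit (pos p) ∷ lit (neg p) ∷ [])
  hyp   : ∀ {Γ} → Γ ∈ H → Deriv S H Γ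
  exch  : ∀ {Γ Δ} → Γ ↭ Δ → Deriv S H Γ → Deriv S H Δ
  rule1 : ∀ {r Γ Δ} → S r ≡ true → Inst1 r Γ Δ → Deriv S H Γ → Deriv S H Δ
  rule2 : ∀ {r Γ₁ Γ₂ Δ} → S r ≡ true → Inst2 r Γ₁ Γ₂ Δ →
          Deriv S H Γ₁ → Deriv S H Γ₂ → Deriv S H Δ

RuleDerivable : System → Rule → Set
RuleDerivable S r =
  (∀ Γ Δ → Inst1 r Γ Δ → Deriv S (Γ ∷ []) Δ) ×
  (∀ Γ₁ Γ₂ Δ → Inst2 r Γ₁ Γ₂ Δ → Deriv S (Γ₁ ∷ Γ₂ ∷ []) Δ)

Contains : System → System → Set
Contains S T = ∀ r → T r ≡ true → RuleDerivable S r

Equivalent : System → System → Set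
Equivalent S T = Contains S T × Contains T S

Complete : System → Set
Complete S = ∀ A → Valid A → Deriv S [] (A ∷ [])

module Submission where

-- Without contraction and weakening every rule introduces a compound formula at the head of
-- its conclusion, so a derivable sequent of literals is an axiom P, P̄, and a derivable sequent
-- A ∘ B, Γ with Γ literal must end with a rule introducing A ∘ B. Inverting derivations of three
-- valid formulas then shows each rule of Mp to be necessary: P ∨ P̄ needs (par), P ∨ (P̄ ∨ Q)
-- needs (⊕), and P ∨ (Q ∨ (P̄ ∧ (P̄ ∧ Q̄))) needs (∧), because the context P, Q has to reach both
-- P̄ and P̄ ∧ Q̄, which neither (&) (it hands Q to P̄ as well) nor (⊗) (it cannot share P) allows.
-- Conversely (⊗) and (&) are the instances of (∧) with no shared, resp. no private, context.

open import Defs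
open import Data.Bool using (true; false)
open import Data.Bool.Properties using (¬-not)
open import Data.List using ([]; _∷_; _++_; length)
open import Data.List.Properties using (++-identityʳ)
open import Data.List.Relation.Unary.All as All using (All; []; _∷_)
open import Data.List.Relation.Unary.All.Properties using (++⁻)
open import Data.List.Relation.Unary.Any using (here; there)
open import Data.List.Relation.Binary.Permutation.Propositional
  using (_↭_; prep; swap; ↭-refl; ↭-sym; ↭-trans; ↭-reflexive)
open import Data.List.Relation.Binary.Permutation.Propositional.Properties
  using (drop-∷; ∈-resp-↭; All-resp-↭; ↭-length; ↭-singleton-inv)
open import Data.Nat using (ℕ; _≤_; z≤n; s≤s; s≤s⁻¹)
open import Data.Nat.Properties using (m≤n⇒m≤1+n)
open import Data.Product using (∃; _×_; _,_; proj₁)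
open import Relation.Nullary using (¬_; contradiction)
open import Relation.Binary.PropositionalEquality using (_≡_; refl; sym; cong; subst)

data IsLiteral : Formula → Set where
  literal : ∀ l → IsLiteral (lit l)

data Positive : Formula → Set where
  positive : ∀ p → Positive (lit (pos p))

positives⇒literals : ∀ {Γ} → All Positive Γ → All IsLiteral Γ
positives⇒literals = All.map λ { (positive p) → literal (pos p) }

axiom-sequent : ℕ → Sequent
axiom-sequent p = lit (pos p) ∷ lit (neg p) ∷ []

axiom-literals : ∀ p → All IsLiteral (axiom-sequent p)
axiom-literals p = literal _ ∷ literal _ ∷ []

compound∉literals : ∀ {A Γ Δ} → ¬ IsLiteral A → A ∷ Γ ↭ Δ → ¬ All IsLiteral Δ
compound∉literals compound σ lits = compound (All.lookup lits (∈-resp-↭ σ (here refl)))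

compound-head-match : ∀ {A B Γ Δ} → A ∷ Γ ↭ B ∷ Δ → ¬ IsLiteral A → All IsLiteral Δ →
                      A ≡ B × Γ ↭ Δ
compound-head-match σ compound lits with ∈-resp-↭ σ (here refl)
... | here refl  = refl , drop-∷ σ
... | there A∈Δ = contradiction (All.lookup lits A∈Δ) compound

length-≤-resp-↭ : ∀ {Γ Δ : Sequent} {k} → Γ ↭ Δ → length Δ ≤ k → length Γ ≤ k
length-≤-resp-↭ {k = k} σ = subst (_≤ k) (sym (↭-length σ))

false⇒¬true : ∀ {b} → b ≡ false → ¬ b ≡ true
false⇒¬true refl ()

present⇒derivable : ∀ S r → S r ≡ true → RuleDerivable S r
present⇒derivable S r present =
    (λ _ _ instance₁ → rule1 present instance₁ (hyp (here refl)))
  , (λ _ _ _ instance₂ → rule2 present instance₂ (hyp (here refl)) (hyp (there (here refl))))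

tensor-from-wedge : ∀ {S} → S wedgeR ≡ true → RuleDerivable S tensorR
tensor-from-wedge wedge∈S =
    (λ _ _ ())
  , λ { _ _ _ (tensor Δ Σ A B) →
          rule2 wedge∈S (wedge [] Δ Σ A B) (hyp (here refl)) (hyp (there (here refl))) }

with-from-wedge : ∀ {S} → S wedgeR ≡ true → RuleDerivable S withR
with-from-wedge wedge∈S =
    (λ _ _ ())
  , λ { _ _ _ (with& Γ A B) →
          exch (↭-reflexive (cong (A ∧ᶠ B ∷_) (++-identityʳ Γ)))
            (rule2 wedge∈S (wedge Γ [] [] A B)
              (exch (Γ↭Γ++[] A Γ) (hyp (here refl)))
              (exch (Γ↭Γ++[] B Γ) (hyp (there (here refl))))) }
  where
  Γ↭Γ++[] : ∀ A Γ → A ∷ Γ ↭ A ∷ Γ ++ []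
  Γ↭Γ++[] A Γ = ↭-reflexive (cong (A ∷_) (sym (++-identityʳ Γ)))

Mp-contains : ∀ {S} → S contrR ≡ false → S weakR ≡ false → Contains Mp S
Mp-contains _ _ tensorR _ = tensor-from-wedge refl
Mp-contains _ _ withR   _ = with-from-wedge refl
Mp-contains _ _ wedgeR  _ = present⇒derivable Mp wedgeR refl
Mp-contains _ _ oplusR  _ = present⇒derivable Mp oplusR refl
Mp-contains _ _ parR    _ = present⇒derivable Mp parR refl
Mp-contains no-contr _ contrR contr∈S = contradiction contr∈S (false⇒¬true no-contr)
Mp-contains _ no-weak  weakR  weak∈S  = contradiction weak∈S (false⇒¬true no-weak)

P Q : Formula
P = lit (pos 0)
Q = lit (pos 1)

module ContractionWeakeningFree
  (S : System) (no-contr : S contrR ≡ false) (no-weak : S weakR ≡ false) where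

  D : Sequent → Set
  D = Deriv S []

  data ∨-Premises (A B : Formula) (Γ : Sequent) : Set where
    oplus₁ : S oplusR ≡ true → D (A ∷ Γ) → ∨-Premises A B Γ
    oplus₂ : S oplusR ≡ true → D (B ∷ Γ) → ∨-Premises A B Γ
    par    : S parR ≡ true → D (A ∷ B ∷ Γ) → ∨-Premises A B Γ

  data ∧-Premises (A B : Formula) (Γ : Sequent) : Set where
    with&  : S withR ≡ true → D (A ∷ Γ) → D (B ∷ Γ) → ∧-Premises A B Γ
    tensor : ∀ {Δ Σ} → S tensorR ≡ true → Δ ++ Σ ↭ Γ →
             D (A ∷ Δ) → D (B ∷ Σ) → ∧-Premises A B Γ
    wedge  : ∀ {Γ₀ Δ Σ} → S wedgeR ≡ true → Γ₀ ++ Δ ++ Σ ↭ Γ →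
             D (A ∷ Γ₀ ++ Δ) → D (B ∷ Γ₀ ++ Σ) → ∧-Premises A B Γ

  ∨-premises-resp-↭ : ∀ {A B Γ Δ} → Γ ↭ Δ → ∨-Premises A B Γ → ∨-Premises A B Δ
  ∨-premises-resp-↭ σ (oplus₁ present d) = oplus₁ present (exch (prep _ σ) d)
  ∨-premises-resp-↭ σ (oplus₂ present d) = oplus₂ present (exch (prep _ σ) d)
  ∨-premises-resp-↭ σ (par present d)    = par present (exch (prep _ (prep _ σ)) d)

  ∧-premises-resp-↭ : ∀ {A B Γ Δ} → Γ ↭ Δ → ∧-Premises A B Γ → ∧-Premises A B Δ
  ∧-premises-resp-↭ σ (with& present d₁ d₂) =
    with& present (exch (prep _ σ) d₁) (exch (prep _ σ) d₂)
  ∧-premises-resp-↭ σ (tensor present τ d₁ d₂) = tensor present (↭-trans τ σ) d₁ d₂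
  ∧-premises-resp-↭ σ (wedge {Γ₀} {Δ} {Σ} present τ d₁ d₂) =
    wedge {Γ₀ = Γ₀} {Δ} {Σ} present (↭-trans τ σ) d₁ d₂

  data LastRule (Δ : Sequent) : Set where
    axiom  : ∀ p → axiom-sequent p ↭ Δ → LastRule Δ
    ∨-rule : ∀ {A B Γ} → ∨-Premises A B Γ → A ∨ᶠ B ∷ Γ ↭ Δ → LastRule Δ
    ∧-rule : ∀ {A B Γ} → ∧-Premises A B Γ → A ∧ᶠ B ∷ Γ ↭ Δ → LastRule Δ

  last-rule : ∀ {Δ} → D Δ → LastRule Δ
  last-rule (ax p) = axiom p ↭-refl
  last-rule (hyp ())
  last-rule (exch σ d) with last-rule d
  ... | axiom p τ     = axiom p (↭-trans τ σ)
  ... | ∨-rule prem τ = ∨-rule prem (↭-trans τ σ)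
  ... | ∧-rule prem τ = ∧-rule prem (↭-trans τ σ)
  last-rule (rule1 present (oplus₁ _ _ _) d) = ∨-rule (oplus₁ present d) ↭-refl
  last-rule (rule1 present (oplus₂ _ _ _) d) = ∨-rule (oplus₂ present d) ↭-refl
  last-rule (rule1 present (par _ _ _) d)    = ∨-rule (par present d) ↭-refl
  last-rule (rule1 present (weak _ _ _) _)   = contradiction present (false⇒¬true no-weak)
  last-rule (rule1 present (contr _ _) _)    = contradiction present (false⇒¬true no-contr)
  last-rule (rule2 present (with& _ _ _) d₁ d₂) = ∧-rule (with& present d₁ d₂) ↭-refl
  last-rule (rule2 present (tensor _ _ _ _) d₁ d₂) = ∧-rule (tensor present ↭-refl d₁ d₂) ↭-refl
  last-rule (rule2 present (wedge Γ₀ Δ Σ _ _) d₁ d₂) =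
    ∧-rule (wedge {Γ₀ = Γ₀} {Δ} {Σ} present ↭-refl d₁ d₂) ↭-refl

  literals⇒axiom : ∀ {Δ} → D Δ → All IsLiteral Δ → ∃ λ p → axiom-sequent p ↭ Δ
  literals⇒axiom d lits with last-rule d
  ... | axiom p σ    = p , σ
  ... | ∨-rule _ σ   = contradiction lits (compound∉literals (λ ()) σ)
  ... | ∧-rule _ σ   = contradiction lits (compound∉literals (λ ()) σ)

  ∨-inversion : ∀ {A B Γ} → D (A ∨ᶠ B ∷ Γ) → All IsLiteral Γ → ∨-Premises A B Γ
  ∨-inversion d lits with last-rule d
  ... | axiom p σ = contradiction (axiom-literals p) (compound∉literals (λ ()) (↭-sym σ))
  ... | ∨-rule prem σ with refl , τ ← compound-head-match σ (λ ()) lits = ∨-premises-resp-↭ τ prem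
  ... | ∧-rule _ σ = contradiction (proj₁ (compound-head-match σ (λ ()) lits)) λ ()

  ∧-inversion : ∀ {A B Γ} → D (A ∧ᶠ B ∷ Γ) → All IsLiteral Γ → ∧-Premises A B Γ
  ∧-inversion d lits with last-rule d
  ... | axiom p σ = contradiction (axiom-literals p) (compound∉literals (λ ()) (↭-sym σ))
  ... | ∨-rule _ σ = contradiction (proj₁ (compound-head-match σ (λ ()) lits)) λ ()
  ... | ∧-rule prem σ with refl , τ ← compound-head-match σ (λ ()) lits = ∧-premises-resp-↭ τ prem

  literal-sequent-length : ∀ {Δ} → D Δ → All IsLiteral Δ → length Δ ≡ 2
  literal-sequent-length d lits with _ , σ ← literals⇒axiom d lits = sym (↭-length σ)

  positives-underivable : ∀ {Γ} → All Positive Γ → ¬ D Γ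
  positives-underivable positives d with _ , σ ← literals⇒axiom d (positives⇒literals positives)
    with () ← All.lookup positives (∈-resp-↭ σ (there (here refl)))

  negative-partner : ∀ {q Γ} → D (lit (neg q) ∷ Γ) → All Positive Γ → Γ ≡ lit (pos q) ∷ []
  negative-partner d positives
    with _ , σ ← literals⇒axiom d (literal _ ∷ positives⇒literals positives)
    with ∈-resp-↭ σ (there (here refl))
  ... | here refl = ↭-singleton-inv (drop-∷ (↭-trans (↭-sym σ) (swap _ _ ↭-refl)))
  ... | there neg∈Γ with () ← All.lookup positives neg∈Γ

  par-witness-underivable : S parR ≡ false → ¬ D (P ∨ᶠ ¬ᶠ P ∷ [])
  par-witness-underivable no-par d with ∨-inversion d []
  ... | oplus₁ _ d₁ = contradiction (literal-sequent-length d₁ (literal _ ∷ [])) λ ()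
  ... | oplus₂ _ d₂ = contradiction (literal-sequent-length d₂ (literal _ ∷ [])) λ ()
  ... | par present _ = contradiction present (false⇒¬true no-par)

  oplus-witness-underivable : S oplusR ≡ false → ¬ D (P ∨ᶠ ¬ᶠ P ∨ᶠ Q ∷ [])
  oplus-witness-underivable no-oplus d with ∨-inversion d []
  ... | oplus₁ present _ = contradiction present (false⇒¬true no-oplus)
  ... | oplus₂ present _ = contradiction present (false⇒¬true no-oplus)
  ... | par _ d′ with ∨-inversion (exch (swap _ _ ↭-refl) d′) (literal _ ∷ [])
  ...   | oplus₁ present _ = contradiction present (false⇒¬true no-oplus)
  ...   | oplus₂ present _ = contradiction present (false⇒¬true no-oplus)
  ...   | par _ d″ =
    contradiction (literal-sequent-length d″ (literal _ ∷ literal _ ∷ literal _ ∷ [])) λ ()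

  module _ (no-wedge : S wedgeR ≡ false) where

    ¬P∧¬Q-underivable : ∀ {Γ} → All Positive Γ → length Γ ≤ 1 → ¬ D (¬ᶠ P ∧ᶠ ¬ᶠ Q ∷ Γ)
    ¬P∧¬Q-underivable positives short d with ∧-inversion d (positives⇒literals positives)
    ¬P∧¬Q-underivable positives short d | with& _ d₁ d₂
      with refl ← negative-partner d₁ positives
      with () ← negative-partner d₂ positives
    ¬P∧¬Q-underivable positives short d | tensor {Δ} _ σ d₁ d₂
      with posΔ , posΣ ← ++⁻ Δ (All-resp-↭ (↭-sym σ) positives)
      with refl ← negative-partner d₁ posΔ | refl ← negative-partner d₂ posΣ
      = contradiction (length-≤-resp-↭ σ short) λ { (s≤s ()) }
    ¬P∧¬Q-underivable positives short d | wedge present _ _ _ =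
      contradiction present (false⇒¬true no-wedge)

    ¬P∧¬P∧¬Q-underivable : ∀ {Γ} → All Positive Γ → length Γ ≤ 2 →
                           ¬ D (¬ᶠ P ∧ᶠ ¬ᶠ P ∧ᶠ ¬ᶠ Q ∷ Γ)
    ¬P∧¬P∧¬Q-underivable positives short d with ∧-inversion d (positives⇒literals positives)
    ... | with& _ d₁ d₂ with refl ← negative-partner d₁ positives =
      ¬P∧¬Q-underivable (positive _ ∷ []) (s≤s z≤n) d₂
    ¬P∧¬P∧¬Q-underivable positives short d | tensor {Δ} _ σ d₁ d₂
      with posΔ , posΣ ← ++⁻ Δ (All-resp-↭ (↭-sym σ) positives)
      with refl ← negative-partner d₁ posΔ =
      ¬P∧¬Q-underivable posΣ (s≤s⁻¹ (length-≤-resp-↭ σ short)) d₂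
    ¬P∧¬P∧¬Q-underivable positives short d | wedge present _ _ _ =
      contradiction present (false⇒¬true no-wedge)

    Q∨¬P∧¬P∧¬Q-underivable : ∀ {Γ} → All Positive Γ → length Γ ≤ 1 →
                             ¬ D (Q ∨ᶠ ¬ᶠ P ∧ᶠ ¬ᶠ P ∧ᶠ ¬ᶠ Q ∷ Γ)
    Q∨¬P∧¬P∧¬Q-underivable positives short d with ∨-inversion d (positives⇒literals positives)
    ... | oplus₁ _ d₁ = positives-underivable (positive _ ∷ positives) d₁
    ... | oplus₂ _ d₂ = ¬P∧¬P∧¬Q-underivable positives (m≤n⇒m≤1+n short) d₂
    ... | par _ d′    =
      ¬P∧¬P∧¬Q-underivable (positive _ ∷ positives) (s≤s short) (exch (swap _ _ ↭-refl) d′)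

    wedge-witness-underivable : ¬ D (P ∨ᶠ Q ∨ᶠ ¬ᶠ P ∧ᶠ ¬ᶠ P ∧ᶠ ¬ᶠ Q ∷ [])
    wedge-witness-underivable d with ∨-inversion d []
    ... | oplus₁ _ d₁ = positives-underivable (positive _ ∷ []) d₁
    ... | oplus₂ _ d₂ = Q∨¬P∧¬P∧¬Q-underivable [] z≤n d₂
    ... | par _ d′    =
      Q∨¬P∧¬P∧¬Q-underivable (positive _ ∷ []) (s≤s z≤n) (exch (swap _ _ ↭-refl) d′)

par-witness-valid : Valid (P ∨ᶠ ¬ᶠ P)
par-witness-valid ρ with ρ 0
... | true  = refl
... | false = refl

oplus-witness-valid : Valid (P ∨ᶠ ¬ᶠ P ∨ᶠ Q)
oplus-witness-valid ρ with ρ 0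
... | true  = refl
... | false = refl

wedge-witness-valid : Valid (P ∨ᶠ Q ∨ᶠ ¬ᶠ P ∧ᶠ ¬ᶠ P ∧ᶠ ¬ᶠ Q)
wedge-witness-valid ρ with ρ 0 | ρ 1
... | true  | _     = refl
... | false | true  = refl
... | false | false = refl

complete⇒present : ∀ {S A} r → Complete S → Valid A →
                   (S r ≡ false → ¬ Deriv S [] (A ∷ [])) → S r ≡ true
complete⇒present r complete valid underivable =
  ¬-not λ absent → underivable absent (complete _ valid)

lemma22 : (S : System) → Complete S → S contrR ≡ false → S weakR ≡ false →
            Equivalent S Mp
lemma22 S complete no-contr no-weak = S-contains-Mp , Mp-contains no-contr no-weak
  where
  open ContractionWeakeningFree S no-contr no-weak

  S-contains-Mp : Contains S Mp
  S-contains-Mp wedgeR _ = present⇒derivable S wedgeR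
    (complete⇒present wedgeR complete wedge-witness-valid wedge-witness-underivable)
  S-contains-Mp oplusR _ = present⇒derivable S oplusR
    (complete⇒present oplusR complete oplus-witness-valid oplus-witness-underivable)
  S-contains-Mp parR _ = present⇒derivable S parR
    (complete⇒present parR complete par-witness-valid par-witness-underivable)
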